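{- For every $\alpha\in\{\mathbf{0},\mathbf{1}\}^*$ we have $F\vdash\forall x\big[x\sqsubseteq\overline{\alpha}\to\bigvee_{\beta\in[\varepsilon\ldots\alpha]}x=\overline{\beta}\big]$.
   Context: Bit strings are elements of $\{\mathbf{0},\mathbf{1}\}^*$; $\varepsilon$ is the empty string, $|\alpha|$ the length. The language $\mathcal{L}_{BT}$ has constant symbols $e,0,1$, binary function symbol $\circ$ (also written as juxtaposition), and binary relation symbol $\sqsubseteq$. Biterals: $\overline{\varepsilon}=e$, $\overline{\alpha\mathbf{0}}=\overline{\alpha}\circ 0$, $\overline{\alpha\mathbf{1}}=\overline{\alpha}\circ 1$. For $\alpha\in\{\mathbf{0},\mathbf{1}\}^*$ let $[\varepsilon\ldots\alpha]=\{\beta\in\{\mathbf{0},\mathbf{1}\}^*:|\beta|\le|\alpha|\}$. The theory $F$ has the axioms: (1) $\forall x[x=ex\wedge x=xe]$; (2) $\forall xyz[(xy)z=x(yz)]$; (3) $\forall xy[x\neq y\to(x0\neq y0\wedge x1\neq y1)]$; (4) $\forall xy[x0\neq y1]$; (5) $\forall x[e\sqsubseteq x]$; (6) $\forall x[x\sqsubseteq e\to x=e]$; (7)–(10): for each $a,b\in\{0,1\}$, $\forall xy[xa\sqsubseteq yb\leftrightarrow x\sqsubseteq y]$; (11) $\forall x[x=e\vee\exists y[x=y0\vee x=y1]]$. -}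

module Defs where

open import Data.Nat using (ℕ; zero; suc)
open import Data.Fin using (Fin; zero; suc)
open import Data.Bool using (Bool; true; false)
open import Data.List using (List; []; _∷_; map; foldl; concatMap; _++_)

infixl 7 _∙_
infix  5 _≐_ _⊑_
infixr 4 _∧_
infixr 3 _∨_
infixr 2 _⇒_
infix  1 _⇔_
infix  5 _≠_

data Term (n : ℕ) : Set where
  var  : Fin n → Term n
  e    : Term n
  𝟘    : Term n
  𝟙    : Term n
  _∙_  : Term n → Term n → Term n

data Formula (n : ℕ) : Set where
  ⊥'   : Formula n
  _≐_  : Term n → Term n → Formula n
  _⊑_  : Term n → Term n → Formula n
  _⇒_  : Formula n → Formula n → Formula n
  _∧_  : Formula n → Formula n → Formula n
  _∨_  : Formula n → Formula n → Formula n
  ∀'   : Formula (suc n) → Formula n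
  ∃'   : Formula (suc n) → Formula n

¬' : ∀ {n} → Formula n → Formula n
¬' φ = φ ⇒ ⊥'

_⇔_ : ∀ {n} → Formula n → Formula n → Formula n
φ ⇔ ψ = (φ ⇒ ψ) ∧ (ψ ⇒ φ)

_≠_ : ∀ {n} → Term n → Term n → Formula n
s ≠ t = ¬' (s ≐ t)

Ren : ℕ → ℕ → Set
Ren m n = Fin m → Fin n

extR : ∀ {m n} → Ren m n → Ren (suc m) (suc n)
extR ρ zero    = zero
extR ρ (suc i) = suc (ρ i)

renT : ∀ {m n} → Ren m n → Term m → Term n
renT ρ (var i) = var (ρ i)
renT ρ e       = e
renT ρ 𝟘       = 𝟘
renT ρ 𝟙       = 𝟙
renT ρ (s ∙ t) = renT ρ s ∙ renT ρ t

renF : ∀ {m n} → Ren m n → Formula m → Formula n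
renF ρ ⊥'      = ⊥'
renF ρ (s ≐ t) = renT ρ s ≐ renT ρ t
renF ρ (s ⊑ t) = renT ρ s ⊑ renT ρ t
renF ρ (φ ⇒ ψ) = renF ρ φ ⇒ renF ρ ψ
renF ρ (φ ∧ ψ) = renF ρ φ ∧ renF ρ ψ
renF ρ (φ ∨ ψ) = renF ρ φ ∨ renF ρ ψ
renF ρ (∀' φ)  = ∀' (renF (extR ρ) φ)
renF ρ (∃' φ)  = ∃' (renF (extR ρ) φ)

Sub : ℕ → ℕ → Set
Sub m n = Fin m → Term n

extS : ∀ {m n} → Sub m n → Sub (suc m) (suc n)
extS σ zero    = var zero
extS σ (suc i) = renT suc (σ i)

subT : ∀ {m n} → Sub m n → Term m → Term n
subT σ (var i) = σ i
subT σ e       = e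
subT σ 𝟘       = 𝟘
subT σ 𝟙       = 𝟙
subT σ (s ∙ t) = subT σ s ∙ subT σ t

subF : ∀ {m n} → Sub m n → Formula m → Formula n
subF σ ⊥'      = ⊥'
subF σ (s ≐ t) = subT σ s ≐ subT σ t
subF σ (s ⊑ t) = subT σ s ⊑ subT σ t
subF σ (φ ⇒ ψ) = subF σ φ ⇒ subF σ ψ
subF σ (φ ∧ ψ) = subF σ φ ∧ subF σ ψ
subF σ (φ ∨ ψ) = subF σ φ ∨ subF σ ψ
subF σ (∀' φ)  = ∀' (subF (extS σ) φ)
subF σ (∃' φ)  = ∃' (subF (extS σ) φ)

sub0 : ∀ {n} → Term n → Sub (suc n) n
sub0 t zero    = t
sub0 t (suc i) = var i

_[_] : ∀ {n} → Formula (suc n) → Term n → Formula n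
φ [ t ] = subF (sub0 t) φ

wkF : ∀ {n} → Formula n → Formula (suc n)
wkF = renF suc

closeF : ∀ {n} → Formula 0 → Formula n
closeF = renF (λ ())

v0 : ∀ {n} → Term (suc n)
v0 = var zero
v1 : ∀ {n} → Term (suc (suc n))
v1 = var (suc zero)
v2 : ∀ {n} → Term (suc (suc (suc n)))
v2 = var (suc (suc zero))

bit : ∀ {n} → Bool → Term n
bit false = 𝟘
bit true  = 𝟙

-- In ∀x∀y…, x is the outer variable (index 1), y the inner one (index 0).
data AxF : Formula 0 → Set where
  ax1  : AxF (∀' (v0 ≐ e ∙ v0 ∧ v0 ≐ v0 ∙ e))
  ax2  : AxF (∀' (∀' (∀' ((v2 ∙ v1) ∙ v0 ≐ v2 ∙ (v1 ∙ v0)))))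
  ax3  : AxF (∀' (∀' (v1 ≠ v0 ⇒ (v1 ∙ 𝟘 ≠ v0 ∙ 𝟘 ∧ v1 ∙ 𝟙 ≠ v0 ∙ 𝟙))))
  ax4  : AxF (∀' (∀' (v1 ∙ 𝟘 ≠ v0 ∙ 𝟙)))
  ax5  : AxF (∀' (e ⊑ v0))
  ax6  : AxF (∀' (v0 ⊑ e ⇒ v0 ≐ e))
  -- axioms (7)–(10), one for each a, b ∈ {0,1}
  ax7-10 : (a b : Bool) →
           AxF (∀' (∀' (v1 ∙ bit a ⊑ v0 ∙ bit b ⇔ v1 ⊑ v0)))
  ax11 : AxF (∀' (v0 ≐ e ∨ ∃' (v1 ≐ v0 ∙ 𝟘 ∨ v1 ≐ v0 ∙ 𝟙)))

Ctx : ℕ → Set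
Ctx n = List (Formula n)

data _∈_ {A : Set} (x : A) : List A → Set where
  here  : ∀ {xs} → x ∈ (x ∷ xs)
  there : ∀ {y xs} → x ∈ xs → x ∈ (y ∷ xs)

infix 0 _⊢F_

data _⊢F_ {n : ℕ} (Γ : Ctx n) : Formula n → Set where
  axiom : ∀ {φ} → AxF φ → Γ ⊢F closeF φ
  hyp   : ∀ {φ} → φ ∈ Γ → Γ ⊢F φ
  ⊥E    : ∀ {φ} → Γ ⊢F ⊥' → Γ ⊢F φ
  raa   : ∀ {φ} → (¬' φ ∷ Γ) ⊢F ⊥' → Γ ⊢F φ
  ⇒I    : ∀ {φ ψ} → (φ ∷ Γ) ⊢F ψ → Γ ⊢F φ ⇒ ψ
  ⇒E    : ∀ {φ ψ} → Γ ⊢F φ ⇒ ψ → Γ ⊢F φ → Γ ⊢F ψ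
  ∧I    : ∀ {φ ψ} → Γ ⊢F φ → Γ ⊢F ψ → Γ ⊢F φ ∧ ψ
  ∧E₁   : ∀ {φ ψ} → Γ ⊢F φ ∧ ψ → Γ ⊢F φ
  ∧E₂   : ∀ {φ ψ} → Γ ⊢F φ ∧ ψ → Γ ⊢F ψ
  ∨I₁   : ∀ {φ ψ} → Γ ⊢F φ → Γ ⊢F φ ∨ ψ
  ∨I₂   : ∀ {φ ψ} → Γ ⊢F ψ → Γ ⊢F φ ∨ ψ
  ∨E    : ∀ {φ ψ χ} → Γ ⊢F φ ∨ ψ → (φ ∷ Γ) ⊢F χ → (ψ ∷ Γ) ⊢F χ → Γ ⊢F χ
  ∀I    : ∀ {φ} → map wkF Γ ⊢F φ → Γ ⊢F ∀' φ
  ∀E    : ∀ {φ} (t : Term n) → Γ ⊢F ∀' φ → Γ ⊢F φ [ t ]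
  ∃I    : ∀ {φ} (t : Term n) → Γ ⊢F φ [ t ] → Γ ⊢F ∃' φ
  ∃E    : ∀ {φ ψ} → Γ ⊢F ∃' φ → (φ ∷ map wkF Γ) ⊢F wkF ψ → Γ ⊢F ψ
  ≐refl : ∀ (t : Term n) → Γ ⊢F t ≐ t
  ≐subst : ∀ {s t} (φ : Formula (suc n)) → Γ ⊢F s ≐ t → Γ ⊢F φ [ s ] → Γ ⊢F φ [ t ]

F⊢_ : Formula 0 → Set
F⊢ φ = [] ⊢F φ

BitString : Set
BitString = List Bool     -- false = 𝟎, true = 𝟏; head = first (leftmost) bit

-- biteral: \bar{ε} = e, \bar{α a} = \bar{α} ∘ a
biteral : ∀ {n} → BitString → Term n
biteral = foldl (λ t b → t ∙ bit b) e

len : BitString → ℕ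
len []      = zero
len (_ ∷ β) = suc (len β)

ofLength : ℕ → List BitString
ofLength zero    = [] ∷ []
ofLength (suc k) = map (false ∷_) (ofLength k) ++ map (true ∷_) (ofLength k)

upToLength : ℕ → List BitString
upToLength zero    = ofLength zero
upToLength (suc k) = upToLength k ++ ofLength (suc k)

-- [ε…α] = {β : |β| ≤ |α|}, enumerated as a list
range : BitString → List BitString
range α = upToLength (len α)

⋁ : ∀ {n} → List (Formula n) → Formula n
⋁ []       = ⊥'
⋁ (φ ∷ φs) = φ ∨ ⋁ φs

-- Induction on α from its last bit.  For α = ε, axiom (6) gives x = e.
-- If x ⊑ ᾱa, axiom (11) gives x = e or x = y b for some y and bit b; in the
-- second case axioms (7)–(10) give y ⊑ ᾱ, so by induction y = β̄ with
-- |β| ≤ |α|, and then x is the biteral of βb, where |βb| ≤ |αa|.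
module Submission where

open import Defs
open import Data.Bool using (true; false)
open import Data.Nat using (ℕ; zero; suc; _≤_; z≤n; s≤s)
open import Data.Nat.Properties using (≤-reflexive; m≤n⇒m≤1+n; m≤n⇒m<n∨m≡n)
open import Data.Fin using (Fin)
open import Data.List using (List; []; _∷_; _∷ʳ_; map; foldl)
open import Data.List.Properties using (foldl-∷ʳ)
open import Data.List.Reverse using (Reverse; []; _∶_∶ʳ_; reverseView)
open import Data.List.Relation.Unary.Any using (here; there)
open import Data.List.Membership.Propositional renaming (_∈_ to _∈ₗ_)
open import Data.List.Membership.Propositional.Properties
  using (∈-map⁺; ∈-map⁻; ∈-++⁺ˡ; ∈-++⁺ʳ; ∈-++⁻)
open import Data.Product using (_,_)
open import Data.Sum using (inj₁; inj₂; [_,_]′)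
open import Relation.Binary.PropositionalEquality
  using (_≡_; refl; sym; trans; cong; cong₂; subst; subst₂)

private
  variable
    m n : ℕ
    Γ Δ : Ctx n
    s t r u y : Term n
    α : BitString

∈⇒∈ₗ : ∀ {A : Set} {x : A} {xs} → x ∈ xs → x ∈ₗ xs
∈⇒∈ₗ here        = here refl
∈⇒∈ₗ (there x∈) = there (∈⇒∈ₗ x∈)

∈ₗ⇒∈ : ∀ {A : Set} {x : A} {xs} → x ∈ₗ xs → x ∈ xs
∈ₗ⇒∈ (here refl) = here
∈ₗ⇒∈ (there x∈)  = there (∈ₗ⇒∈ x∈)

_⊆_ : Ctx n → Ctx n → Set
Γ ⊆ Δ = ∀ {φ} → φ ∈ Γ → φ ∈ Δ

⊆-∷ : ∀ {φ} → Γ ⊆ Δ → (φ ∷ Γ) ⊆ (φ ∷ Δ)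
⊆-∷ Γ⊆Δ here        = here
⊆-∷ Γ⊆Δ (there ψ∈) = there (Γ⊆Δ ψ∈)

⊆-map-wkF : Γ ⊆ Δ → map wkF Γ ⊆ map wkF Δ
⊆-map-wkF Γ⊆Δ φ∈ with ∈-map⁻ wkF (∈⇒∈ₗ φ∈)
... | _ , ψ∈ , refl = ∈ₗ⇒∈ (∈-map⁺ wkF (∈⇒∈ₗ (Γ⊆Δ (∈ₗ⇒∈ ψ∈))))

weaken : ∀ {φ} → Γ ⊆ Δ → Γ ⊢F φ → Δ ⊢F φ
weaken Γ⊆Δ (axiom ax)        = axiom ax
weaken Γ⊆Δ (hyp φ∈)          = hyp (Γ⊆Δ φ∈)
weaken Γ⊆Δ (⊥E d)            = ⊥E (weaken Γ⊆Δ d)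
weaken Γ⊆Δ (raa d)           = raa (weaken (⊆-∷ Γ⊆Δ) d)
weaken Γ⊆Δ (⇒I d)            = ⇒I (weaken (⊆-∷ Γ⊆Δ) d)
weaken Γ⊆Δ (⇒E d d′)         = ⇒E (weaken Γ⊆Δ d) (weaken Γ⊆Δ d′)
weaken Γ⊆Δ (∧I d d′)         = ∧I (weaken Γ⊆Δ d) (weaken Γ⊆Δ d′)
weaken Γ⊆Δ (∧E₁ d)           = ∧E₁ (weaken Γ⊆Δ d)
weaken Γ⊆Δ (∧E₂ d)           = ∧E₂ (weaken Γ⊆Δ d)
weaken Γ⊆Δ (∨I₁ d)           = ∨I₁ (weaken Γ⊆Δ d)
weaken Γ⊆Δ (∨I₂ d)           = ∨I₂ (weaken Γ⊆Δ d)
weaken Γ⊆Δ (∨E d d₁ d₂)      = ∨E (weaken Γ⊆Δ d) (weaken (⊆-∷ Γ⊆Δ) d₁) (weaken (⊆-∷ Γ⊆Δ) d₂)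
weaken Γ⊆Δ (∀I d)            = ∀I (weaken (⊆-map-wkF Γ⊆Δ) d)
weaken Γ⊆Δ (∀E t d)          = ∀E t (weaken Γ⊆Δ d)
weaken Γ⊆Δ (∃I t d)          = ∃I t (weaken Γ⊆Δ d)
weaken Γ⊆Δ (∃E d d′)         = ∃E (weaken Γ⊆Δ d) (weaken (⊆-∷ (⊆-map-wkF Γ⊆Δ)) d′)
weaken Γ⊆Δ (≐refl t)         = ≐refl t
weaken Γ⊆Δ (≐subst φ d d′)   = ≐subst φ (weaken Γ⊆Δ d) (weaken Γ⊆Δ d′)

wk1 : ∀ {φ ψ} → Γ ⊢F φ → (ψ ∷ Γ) ⊢F φ
wk1 = weaken there

wkT : Term n → Term (suc n)
wkT = renT Fin.suc

subT-sub0-wkT : ∀ (u w : Term n) → subT (sub0 u) (wkT w) ≡ w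
subT-sub0-wkT u (var i) = refl
subT-sub0-wkT u e       = refl
subT-sub0-wkT u 𝟘       = refl
subT-sub0-wkT u 𝟙       = refl
subT-sub0-wkT u (w ∙ w′) = cong₂ _∙_ (subT-sub0-wkT u w) (subT-sub0-wkT u w′)

biteral-∷ʳ : ∀ α a → biteral {n} (α ∷ʳ a) ≡ biteral α ∙ bit a
biteral-∷ʳ α a = foldl-∷ʳ (λ t b → t ∙ bit b) e a α

subT-bit : ∀ (σ : Sub m n) a → subT σ (bit a) ≡ bit a
subT-bit σ false = refl
subT-bit σ true  = refl

renT-bit : ∀ (ρ : Ren m n) a → renT ρ (bit a) ≡ bit a
renT-bit ρ false = refl
renT-bit ρ true  = refl

subT-foldl-bits : ∀ (σ : Sub m n) t α →
  subT σ (foldl (λ t b → t ∙ bit b) t α) ≡ foldl (λ t b → t ∙ bit b) (subT σ t) α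
subT-foldl-bits σ t []      = refl
subT-foldl-bits σ t (a ∷ α) rewrite sym (subT-bit σ a) = subT-foldl-bits σ (t ∙ bit a) α

renT-foldl-bits : ∀ (ρ : Ren m n) t α →
  renT ρ (foldl (λ t b → t ∙ bit b) t α) ≡ foldl (λ t b → t ∙ bit b) (renT ρ t) α
renT-foldl-bits ρ t []      = refl
renT-foldl-bits ρ t (a ∷ α) rewrite sym (renT-bit ρ a) = renT-foldl-bits ρ (t ∙ bit a) α

subT-biteral : ∀ (σ : Sub m n) α → subT σ (biteral α) ≡ biteral α
subT-biteral σ = subT-foldl-bits σ e

renT-biteral : ∀ (ρ : Ren m n) α → renT ρ (biteral α) ≡ biteral α
renT-biteral ρ = renT-foldl-bits ρ e

_≐-one-of_ : Term n → List BitString → Formula n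
t ≐-one-of L = ⋁ (map (λ β → t ≐ biteral β) L)

subF-≐-one-of : ∀ (σ : Sub m n) s L → subF σ (s ≐-one-of L) ≡ subT σ s ≐-one-of L
subF-≐-one-of σ s []      = refl
subF-≐-one-of σ s (β ∷ L) =
  cong₂ _∨_ (cong (subT σ s ≐_) (subT-biteral σ β)) (subF-≐-one-of σ s L)

renF-≐-one-of : ∀ (ρ : Ren m n) s L → renF ρ (s ≐-one-of L) ≡ renT ρ s ≐-one-of L
renF-≐-one-of ρ s []      = refl
renF-≐-one-of ρ s (β ∷ L) =
  cong₂ _∨_ (cong (renT ρ s ≐_) (renT-biteral ρ β)) (renF-≐-one-of ρ s L)

cast : ∀ {φ ψ} → φ ≡ ψ → Γ ⊢F φ → Γ ⊢F ψ
cast refl d = d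

≐subst-≡ : ∀ (φ : Formula (suc n)) {A B} →
  φ [ s ] ≡ A → φ [ t ] ≡ B → Γ ⊢F s ≐ t → Γ ⊢F A → Γ ⊢F B
≐subst-≡ φ refl refl = ≐subst φ

≐-trans : Γ ⊢F s ≐ t → Γ ⊢F t ≐ r → Γ ⊢F s ≐ r
≐-trans {s = s} {t = t} {r = r} s≐t t≐r =
  ≐subst-≡ (wkT s ≐ v0) (cong (_≐ t) (subT-sub0-wkT t s)) (cong (_≐ r) (subT-sub0-wkT r s))
    t≐r s≐t

∙-congʳ : ∀ {n} {Γ : Ctx n} {s t} c → Γ ⊢F s ≐ t → Γ ⊢F s ∙ c ≐ t ∙ c
∙-congʳ {n} {s = s} {t} c s≐t = ≐subst-≡ φ (φ[ s ]) (φ[ t ]) s≐t (≐refl (s ∙ c))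
  where
  φ : Formula (suc n)
  φ = wkT (s ∙ c) ≐ v0 ∙ wkT c
  φ[_] : ∀ u → φ [ u ] ≡ (s ∙ c ≐ u ∙ c)
  φ[ u ] = cong₂ (λ l r → l ≐ u ∙ r) (subT-sub0-wkT u (s ∙ c)) (subT-sub0-wkT u c)

⊑-substˡ : Γ ⊢F s ≐ t → Γ ⊢F s ⊑ r → Γ ⊢F t ⊑ r
⊑-substˡ {s = s} {t = t} {r = r} =
  ≐subst-≡ (v0 ⊑ wkT r) (cong (s ⊑_) (subT-sub0-wkT s r)) (cong (t ⊑_) (subT-sub0-wkT t r))

⊑-cancel-bits : ∀ {n} {Γ : Ctx n} {s r} a b → Γ ⊢F s ∙ bit a ⊑ r ∙ bit b → Γ ⊢F s ⊑ r
⊑-cancel-bits {n} {Γ} {s} {r} a b =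
  ⇒E (∧E₁ (subst (λ z → Γ ⊢F (z ∙ bit a ⊑ r ∙ bit b ⇔ z ⊑ r)) (subT-sub0-wkT r s) (ax7-10-at a b)))
  where
  s′ : Term n
  s′ = subT (sub0 r) (wkT s)
  ax7-10-at : ∀ a b → Γ ⊢F (s′ ∙ bit a ⊑ r ∙ bit b ⇔ s′ ⊑ r)
  ax7-10-at false false = ∀E r (∀E s (axiom (ax7-10 false false)))
  ax7-10-at false true  = ∀E r (∀E s (axiom (ax7-10 false true)))
  ax7-10-at true  false = ∀E r (∀E s (axiom (ax7-10 true false)))
  ax7-10-at true  true  = ∀E r (∀E s (axiom (ax7-10 true true)))

⋁-intro : ∀ {A : Set} (f : A → Formula n) {L x} → x ∈ₗ L → Γ ⊢F f x → Γ ⊢F ⋁ (map f L)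
⋁-intro f (here refl) d = ∨I₁ d
⋁-intro f (there x∈)  d = ∨I₂ (⋁-intro f x∈ d)

⋁-elim : ∀ {A : Set} (f : A → Formula n) L {χ} →
  Γ ⊢F ⋁ (map f L) → (∀ x → x ∈ₗ L → Γ ⊢F f x ⇒ χ) → Γ ⊢F χ
⋁-elim f []      d cases = ⊥E d
⋁-elim f (x ∷ L) d cases =
  ∨E d (⇒E (wk1 (cases x (here refl))) (hyp here))
       (⋁-elim f L (hyp here) (λ x′ x′∈ → wk1 (cases x′ (there x′∈))))

ofLength-complete : ∀ β → β ∈ₗ ofLength (len β)
ofLength-complete []          = here refl
ofLength-complete (false ∷ β) = ∈-++⁺ˡ (∈-map⁺ (false ∷_) (ofLength-complete β))
ofLength-complete (true ∷ β)  =
  ∈-++⁺ʳ (map (false ∷_) (ofLength (len β))) (∈-map⁺ (true ∷_) (ofLength-complete β))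

ofLength-sound : ∀ k {β} → β ∈ₗ ofLength k → len β ≡ k
ofLength-sound zero    (here refl) = refl
ofLength-sound (suc k) β∈          = [ consed , consed ]′ (∈-++⁻ (map (false ∷_) (ofLength k)) β∈)
  where
  consed : ∀ {a β} → β ∈ₗ map (a ∷_) (ofLength k) → len β ≡ suc k
  consed {a} β∈ with ∈-map⁻ (a ∷_) β∈
  ... | _ , γ∈ , refl = cong suc (ofLength-sound k γ∈)

upToLength-complete : ∀ k {β} → len β ≤ k → β ∈ₗ upToLength k
upToLength-complete zero    {[]} z≤n = here refl
upToLength-complete (suc k) {β} |β|≤ with m≤n⇒m<n∨m≡n |β|≤
... | inj₁ (s≤s |β|≤k) = ∈-++⁺ˡ (upToLength-complete k |β|≤k)
... | inj₂ |β|≡1+k      =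
  ∈-++⁺ʳ (upToLength k) (subst (λ l → β ∈ₗ ofLength l) |β|≡1+k (ofLength-complete β))

upToLength-sound : ∀ k {β} → β ∈ₗ upToLength k → len β ≤ k
upToLength-sound zero    (here refl) = z≤n
upToLength-sound (suc k) β∈ with ∈-++⁻ (upToLength k) β∈
... | inj₁ β∈′ = m≤n⇒m≤1+n (upToLength-sound k β∈′)
... | inj₂ β∈′ = ≤-reflexive (ofLength-sound (suc k) β∈′)

len-∷ʳ : ∀ (β : BitString) b → len (β ∷ʳ b) ≡ suc (len β)
len-∷ʳ []      b = refl
len-∷ʳ (_ ∷ β) b = cong suc (len-∷ʳ β b)

[]∈range : ∀ α → [] ∈ₗ range α
[]∈range α = upToLength-complete (len α) z≤n

∷ʳ∈range-∷ʳ : ∀ {β} a b → β ∈ₗ range α → β ∷ʳ b ∈ₗ range (α ∷ʳ a)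
∷ʳ∈range-∷ʳ {α = α} {β} a b β∈ =
  upToLength-complete _
    (subst₂ _≤_ (sym (len-∷ʳ β b)) (sym (len-∷ʳ α a)) (s≤s (upToLength-sound _ β∈)))

DownsetEnumerated : BitString → Set
DownsetEnumerated α = ∀ {n} {Γ : Ctx n} → Γ ⊢F ∀' (v0 ⊑ biteral α ⇒ v0 ≐-one-of range α)

downset-at : ∀ {L} t → Γ ⊢F ∀' (v0 ⊑ biteral α ⇒ v0 ≐-one-of L) →
  Γ ⊢F t ⊑ biteral α → Γ ⊢F t ≐-one-of L
downset-at {α = α} {L} t d =
  ⇒E (cast (cong₂ (λ b φ → t ⊑ b ⇒ φ) (subT-biteral _ α) (subF-≐-one-of _ v0 L)) (∀E t d))

downset-ε-enumerated : DownsetEnumerated []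
downset-ε-enumerated = ∀I (⇒I (∨I₁ (⇒E (∀E v0 (axiom ax6)) (hyp here))))

enumerated-∙bit : ∀ α a b → DownsetEnumerated α →
  Γ ⊢F u ≐ y ∙ bit b → Γ ⊢F u ⊑ biteral α ∙ bit a → Γ ⊢F u ≐-one-of range (α ∷ʳ a)
enumerated-∙bit {Γ = Γ} {u = u} {y = y} α a b ih u≐yb u⊑αa =
  ⋁-elim (λ β → y ≐ biteral β) (range α) (downset-at {α = α} y ih y⊑α) extend
  where
  y⊑α : Γ ⊢F y ⊑ biteral α
  y⊑α = ⊑-cancel-bits b a (⊑-substˡ u≐yb u⊑αa)
  extend : ∀ β → β ∈ₗ range α → Γ ⊢F y ≐ biteral β ⇒ u ≐-one-of range (α ∷ʳ a)
  extend β β∈ = ⇒I (⋁-intro (λ β → u ≐ biteral β) (∷ʳ∈range-∷ʳ {α = α} a b β∈)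
    (cast (cong (u ≐_) (sym (biteral-∷ʳ β b)))
      (≐-trans (wk1 u≐yb) (∙-congʳ (bit b) (hyp here)))))

downset-∷ʳ-enumerated : ∀ α a → DownsetEnumerated α → DownsetEnumerated (α ∷ʳ a)
downset-∷ʳ-enumerated α a ih =
  ∀I (⇒I (∨E (∀E v0 (axiom ax11))
    (⋁-intro _ ([]∈range (α ∷ʳ a)) (hyp here))
    (∃E (hyp here)
      (cast (sym (renF-≐-one-of Fin.suc v0 (range (α ∷ʳ a))))
        (∨E (hyp here) (enumerated-∙bit α a false ih (hyp here) x⊑αa)
                       (enumerated-∙bit α a true ih (hyp here) x⊑αa))))))
  where
  -- the hypothesis x ⊑ ᾱa, below the ∃-elimination and the case split on the last bit
  x⊑αa : ∀ {k φ ψ χ} {Δ : Ctx (suc (suc k))} →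
    (φ ∷ ψ ∷ χ ∷ wkF (v0 ⊑ biteral (α ∷ʳ a)) ∷ Δ) ⊢F v1 ⊑ biteral α ∙ bit a
  x⊑αa = cast (cong (v1 ⊑_) (trans (renT-biteral Fin.suc (α ∷ʳ a)) (biteral-∷ʳ α a)))
           (hyp (there (there (there here))))

downset-enumerated : ∀ α → DownsetEnumerated α
downset-enumerated α = by-reverse (reverseView α)
  where
  by-reverse : ∀ {α} → Reverse α → DownsetEnumerated α
  by-reverse []             = downset-ε-enumerated
  by-reverse (α ∶ rα ∶ʳ a) = downset-∷ʳ-enumerated α a (by-reverse rα)

lemma13 : ∀ (α : BitString) →
    F⊢ ∀' (v0 ⊑ biteral α ⇒ ⋁ (map (λ β → v0 ≐ biteral β) (range α)))
lemma13 α = downset-enumerated α
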